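{- Let $q$ be a real number, let $G$ be a planar graph, let $e=ab$ be an edge of $G$, and write $w_q(G,e)=\binom{t}{u}$. Then \[ w_q(S(G,e)) = \begin{pmatrix} -1 & 1\\ 0 & q-1 \end{pmatrix} \binom{t}{u}, \qquad w_q(B(G,e)) = \begin{pmatrix} q-1 & 0\\ 1 & q-2 \end{pmatrix} \binom{t}{u}. \]
   Context: $P_G(x)$ denotes the chromatic polynomial (parallel edges do not affect it). $w_q(G,e)\coloneqq\binom{P_{G/e}(q)}{P_{G-e}(q)}$ for an edge $e$ of a planar graph $G$ ($G/e$ contraction, $G-e$ deletion). Operations on a pair $(G,e)$ with $e=ab$: $S(G,e)\coloneqq(G',aw)$, where $G'$ is obtained by subdividing $e$ with a new vertex $w$ (replacing $e$ by the path $a-w-b$); $B(G,e)\coloneqq(G^\ast,e)$, where $G^\ast$ is obtained by adding a new vertex $w$ adjacent to both $a$ and $b$. -}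

module Defs where

open import Data.Nat using (ℕ; zero; suc; _⊔_; _≡ᵇ_)
open import Data.Fin using (Fin; zero; suc; inject₁; fromℕ; punchOut; cast; _≟_)
open import Data.List using (List; []; _∷_; map; length; lookup; removeAt; concatMap; foldr; upTo)
open import Data.List.Properties using (length-map)
open import Data.Vec using (Vec; []; _∷_)
import Data.Vec as Vec
open import Data.Product using (_×_; _,_; proj₁; proj₂)
open import Data.Bool using (Bool; true; false; if_then_else_; _∧_; not)
open import Relation.Nullary using (yes; no)
open import Relation.Binary.PropositionalEquality using (_≡_; _≢_; sym)
open import Algebra.Bundles using (CommutativeRing)

-- Finite multigraphs (loops and parallel edges allowed).
-- Vertex set Fin n, edges given as a list of (unordered) endpoint pairs.

record Graph : Set where
  constructor graph
  field
    n     : ℕ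
    edges : List (Fin n × Fin n)

record Rooted : Set where
  constructor rooted
  field
    G : Graph
    e : Fin (length (Graph.edges G))

delete : Rooted → Graph
delete (rooted (graph n E) e) = graph n (removeAt E e)

-- identify b with a (a ≢ b), renumbering the remaining vertices
mergeV : ∀ {m} (a b : Fin (suc m)) → a ≢ b → Fin (suc m) → Fin m
mergeV a b ne v with v ≟ b
... | yes _   = punchOut {i = b} {j = a} (λ eq → ne (sym eq))
... | no v≢b  = punchOut {i = b} {j = v} (λ eq → v≢b (sym eq))

contractNonLoop : ∀ {n} (a b : Fin n) → a ≢ b → List (Fin n × Fin n) → Graph
contractNonLoop {suc m} a b ne E =
  graph m (map (λ p → mergeV a b ne (proj₁ p) , mergeV a b ne (proj₂ p)) E)

-- Contraction G / e : the edge e is removed and its endpoints identified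
-- (other edges parallel to e become loops).  Contracting a loop = deleting it.
contract : Rooted → Graph
contract (rooted (graph n E) e) with lookup E e
... | (a , b) with a ≟ b
...   | yes _  = graph n (removeAt E e)
...   | no ne  = contractNonLoop a b ne (removeAt E e)

injE : ∀ {n} → Fin n × Fin n → Fin (suc n) × Fin (suc n)
injE (u , v) = inject₁ u , inject₁ v

-- S(G,e) = (G', aw): subdivide e = ab by a new vertex w.
S : Rooted → Rooted
S (rooted (graph n E) e) with lookup E e
... | (a , b) =
  rooted (graph (suc n) ((inject₁ a , fromℕ n) ∷ (fromℕ n , inject₁ b) ∷ map injE (removeAt E e)))
         zero

-- B(G,e) = (G*, e): add a new vertex w adjacent to a and b.
B : Rooted → Rooted
B (rooted (graph n E) e) with lookup E e
... | (a , b) =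
  rooted (graph (suc n) ((inject₁ a , fromℕ n) ∷ (inject₁ b , fromℕ n) ∷ map injE E))
         (suc (suc (cast (sym (length-map injE E)) e)))

-- P_G(x) = Σ_k a_k(G) · x(x-1)…(x-k+1), where a_k(G) is the number of
-- partitions of V(G) into k nonempty independent sets.  Partitions of
-- Fin n are enumerated as restricted growth strings (colour vectors whose
-- colours are introduced in order), paired with their number of blocks.

rgs : (n : ℕ) → List (Vec ℕ n × ℕ)
rgs zero    = ([] , 0) ∷ []
rgs (suc n) = concatMap (λ ck → map (λ j → (j ∷ proj₁ ck) , (proj₂ ck ⊔ suc j)) (upTo (suc (proj₂ ck)))) (rgs n)

-- all edges join differently coloured vertices (loops are never proper)
proper : ∀ {n} → Vec ℕ n → List (Fin n × Fin n) → Bool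
proper c []            = true
proper c ((u , v) ∷ E) = not (Vec.lookup c u ≡ᵇ Vec.lookup c v) ∧ proper c E

module Chromatic {c ℓ} (R : CommutativeRing c ℓ) where
  open CommutativeRing R

  natR : ℕ → Carrier
  natR zero    = 0#
  natR (suc k) = 1# + natR k

  falling : Carrier → ℕ → Carrier
  falling x zero    = 1#
  falling x (suc k) = falling x k * (x - natR k)

  P : Graph → Carrier → Carrier
  P (graph n E) x =
    foldr (λ ck acc → (if proper (proj₁ ck) E then falling x (proj₂ ck) else 0#) + acc) 0# (rgs n)

  w : Carrier → Rooted → Carrier × Carrier
  w x X = P (contract X) x , P (delete X) x

module Submission where

-- For m ∈ ℕ the chromatic polynomial counts proper m-colourings, and the four identities become
-- counting statements: deleting aw from the subdivision leaves G − e with a pendant vertex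
-- (m − 1 choices for w), contracting aw gives back G, where deletion–contraction applies, and in
-- B(G,e) the new vertex has m − 1 or m − 2 admissible colours according as a and b share a colour.
-- Over an arbitrary commutative ring, P_G is a sum of falling factorials x⁽ᵏ⁾ indexed by the
-- partitions of V(G) into k independent sets; since such a ℕ-combination of falling factorials is
-- determined by its values at all m ∈ ℕ, each counting identity holds for the polynomials.

open import Defs
open import Algebra.Bundles using (CommutativeRing; CommutativeSemiring)
open import Data.Bool using (Bool; true; false; if_then_else_; _∧_; _∨_; not; T)
open import Data.Bool.Properties using (∧-zeroʳ; ∧-identityʳ; ∧-assoc)
open import Data.Empty using (⊥-elim)
open import Data.List using (List; []; _∷_; _++_; map; concatMap; upTo; _∷ʳ_; lookup; removeAt; length; filterᵇ; foldr; replicate)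
open import Data.List.Properties using (map-upTo; upTo-∷ʳ; map-cong; map-∘; map-id; map-removeAt; length-map)
open import Data.List.Relation.Unary.All as All using (All; []; _∷_)
import Data.List.Relation.Unary.All.Properties as All
open import Data.Product using (Σ; _×_; _,_; proj₁; proj₂)
open import Data.Sum using (inj₁; inj₂)
open import Data.Fin using (Fin; zero; suc; fromℕ; inject₁; punchIn; cast)
import Data.Fin.Properties as Fin
open import Data.Vec as Vec using (Vec; []; _∷_)
import Data.Vec.Properties as Vec
open import Relation.Nullary using (Dec; yes; no)
open import Function using (_∘_)
open import Data.Nat.Base using (ℕ; zero; suc)
import Data.Nat.Base as ℕ
import Relation.Binary.PropositionalEquality as ≡

module ListSum {c ℓ} (SR : CommutativeSemiring c ℓ) where
  open CommutativeSemiring SR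
  open import Algebra.Properties.CommutativeSemigroup +-commutativeSemigroup using (interchange)

  private variable
    A A′ : Set
    f g : A → Carrier

  ∑ : List A → (A → Carrier) → Carrier
  ∑ []       f = 0#
  ∑ (x ∷ xs) f = f x + ∑ xs f

  ∑-++ : ∀ xs ys (f : A → Carrier) → ∑ (xs ++ ys) f ≈ ∑ xs f + ∑ ys f
  ∑-++ []       ys f = sym (+-identityˡ _)
  ∑-++ (x ∷ xs) ys f = trans (+-congˡ (∑-++ xs ys f)) (sym (+-assoc _ _ _))

  ∑-cong-All : ∀ {P : A → Set} {xs} → All P xs → (∀ {x} → P x → f x ≈ g x) → ∑ xs f ≈ ∑ xs g
  ∑-cong-All []         eq = refl
  ∑-cong-All (px ∷ pxs) eq = +-cong (eq px) (∑-cong-All pxs eq)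

  ∑-cong : ∀ xs → (∀ x → f x ≈ g x) → ∑ xs f ≈ ∑ xs g
  ∑-cong []       eq = refl
  ∑-cong (x ∷ xs) eq = +-cong (eq x) (∑-cong xs eq)

  ∑-zero : ∀ xs → (∀ x → f x ≈ 0#) → ∑ xs f ≈ 0#
  ∑-zero []       eq = refl
  ∑-zero (x ∷ xs) eq = trans (+-cong (eq x) (∑-zero xs eq)) (+-identityˡ 0#)

  ∑-distrib-+ : ∀ xs (f g : A → Carrier) → ∑ xs (λ x → f x + g x) ≈ ∑ xs f + ∑ xs g
  ∑-distrib-+ []       f g = sym (+-identityˡ _)
  ∑-distrib-+ (x ∷ xs) f g = trans (+-congˡ (∑-distrib-+ xs f g)) (interchange _ _ _ _)

  *-distribˡ-∑ : ∀ a xs (f : A → Carrier) → a * ∑ xs f ≈ ∑ xs (λ x → a * f x)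
  *-distribˡ-∑ a []       f = zeroʳ a
  *-distribˡ-∑ a (x ∷ xs) f = trans (distribˡ a _ _) (+-congˡ (*-distribˡ-∑ a xs f))

  ∑-map : ∀ (h : A → A′) xs (f : A′ → Carrier) → ∑ (map h xs) f ≈ ∑ xs (λ x → f (h x))
  ∑-map h []       f = refl
  ∑-map h (x ∷ xs) f = +-congˡ (∑-map h xs f)

  ∑-concatMap : ∀ (h : A → List A′) xs (f : A′ → Carrier) → ∑ (concatMap h xs) f ≈ ∑ xs (λ x → ∑ (h x) f)
  ∑-concatMap h []       f = refl
  ∑-concatMap h (x ∷ xs) f = trans (∑-++ (h x) _ f) (+-congˡ (∑-concatMap h xs f))

  ∑-comm : ∀ xs ys (f : A → A′ → Carrier) → ∑ xs (λ x → ∑ ys (f x)) ≈ ∑ ys (λ y → ∑ xs (λ x → f x y))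
  ∑-comm []       ys f = sym (∑-zero ys (λ _ → refl))
  ∑-comm (x ∷ xs) ys f = trans (+-congˡ (∑-comm xs ys f)) (sym (∑-distrib-+ ys (f x) _))

  ∑-filterᵇ : ∀ (p : A → Bool) xs (f : A → Carrier) → ∑ (filterᵇ p xs) f ≈ ∑ xs (λ x → if p x then f x else 0#)
  ∑-filterᵇ p []       f = refl
  ∑-filterᵇ p (x ∷ xs) f with p x
  ... | true  = +-congˡ (∑-filterᵇ p xs f)
  ... | false = trans (∑-filterᵇ p xs f) (sym (+-identityˡ _))

  foldr≡∑ : ∀ xs (f : A → Carrier) → foldr (λ x acc → f x + acc) 0# xs ≡.≡ ∑ xs f
  foldr≡∑ []       f = ≡.refl
  foldr≡∑ (x ∷ xs) f = ≡.cong (f x +_) (foldr≡∑ xs f)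

  ∑-upTo-suc : ∀ m (f : ℕ → Carrier) → ∑ (upTo (suc m)) f ≈ f 0 + ∑ (upTo m) (f ∘ suc)
  ∑-upTo-suc m f = +-congˡ (trans (reflexive (≡.cong (λ l → ∑ l f) (≡.sym (map-upTo suc m)))) (∑-map suc (upTo m) f))

  ∑-upTo-select : ∀ {m y} (h : ℕ → Carrier) → y ℕ.< m → ∑ (upTo m) (λ i → if i ℕ.≡ᵇ y then h i else 0#) ≈ h y
  ∑-upTo-select {suc m} {zero}  h _ =
    trans (∑-upTo-suc m _) (trans (+-congˡ (∑-zero (upTo m) (λ _ → refl))) (+-identityʳ (h 0)))
  ∑-upTo-select {suc m} {suc y} h (ℕ.s≤s y<m) =
    trans (∑-upTo-suc m _) (trans (+-identityˡ _) (∑-upTo-select (h ∘ suc) y<m))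

  ∑-upTo-select-≥ : ∀ {m y} (h : ℕ → Carrier) → m ℕ.≤ y → ∑ (upTo m) (λ i → if i ℕ.≡ᵇ y then h i else 0#) ≈ 0#
  ∑-upTo-select-≥ {zero}          h _ = refl
  ∑-upTo-select-≥ {suc m} {suc y} h (ℕ.s≤s m≤y) =
    trans (∑-upTo-suc m _) (trans (+-identityˡ _) (∑-upTo-select-≥ (h ∘ suc) m≤y))

module Counting where
  open import Data.Nat.Base using (_+_; _*_; _∸_; _≤_; _<_; s≤s; _⊔_; _≡ᵇ_; NonZero; >-nonZero)
  open import Data.Nat.Properties
  open import Relation.Binary.PropositionalEquality
  open import Algebra.Properties.CommutativeSemigroup +-commutativeSemigroup using (x∙yz≈y∙xz)
  open ListSum +-*-commutativeSemiring public

  ∑-upTo-sucʳ : ∀ m (f : ℕ → ℕ) → ∑ (upTo (suc m)) f ≡ ∑ (upTo m) f + f m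
  ∑-upTo-sucʳ m f = begin
    ∑ (upTo (suc m)) f        ≡⟨ cong (λ l → ∑ l f) (upTo-∷ʳ m) ⟨
    ∑ (upTo m ∷ʳ m) f         ≡⟨ ∑-++ (upTo m) (m ∷ []) f ⟩
    ∑ (upTo m) f + (f m + 0)  ≡⟨ cong (∑ (upTo m) f +_) (+-identityʳ (f m)) ⟩
    ∑ (upTo m) f + f m        ∎
    where open ≡-Reasoning

  ∑-upTo-+ : ∀ k d (f : ℕ → ℕ) → ∑ (upTo (k + d)) f ≡ ∑ (upTo k) f + ∑ (upTo d) (λ i → f (k + i))
  ∑-upTo-+ k zero    f rewrite +-identityʳ k = sym (+-identityʳ _)
  ∑-upTo-+ k (suc d) f
    rewrite +-suc k d | ∑-upTo-sucʳ (k + d) f | ∑-upTo-+ k d f | ∑-upTo-sucʳ d (λ i → f (k + i))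
    = +-assoc (∑ (upTo k) f) _ _

  ∑-upTo-const : ∀ m a → ∑ (upTo m) (λ _ → a) ≡ m * a
  ∑-upTo-const zero    a = refl
  ∑-upTo-const (suc m) a = trans (∑-upTo-suc m (λ _ → a)) (cong (a +_) (∑-upTo-const m a))

  upTo-bounded : ∀ m → All (_< m) (upTo m)
  upTo-bounded m = All.applyUpTo⁺₁ (λ i → i) m (λ i<m → i<m)

  𝟙 : Bool → ℕ
  𝟙 true  = 1
  𝟙 false = 0

  ≡ᵇ-refl : ∀ n → (n ≡ᵇ n) ≡ true
  ≡ᵇ-refl zero    = refl
  ≡ᵇ-refl (suc n) = ≡ᵇ-refl n

  ≡ᵇ-sym : ∀ m n → (m ≡ᵇ n) ≡ (n ≡ᵇ m)
  ≡ᵇ-sym zero    zero    = refl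
  ≡ᵇ-sym zero    (suc n) = refl
  ≡ᵇ-sym (suc m) zero    = refl
  ≡ᵇ-sym (suc m) (suc n) = ≡ᵇ-sym m n

  ≡ᵇ-true⇒≡ : ∀ {m n} → (m ≡ᵇ n) ≡ true → m ≡ n
  ≡ᵇ-true⇒≡ {m} {n} eq = ≡ᵇ⇒≡ m n (subst T (sym eq) _)

  ≢⇒≡ᵇ-false : ∀ {m n} → m ≢ n → (m ≡ᵇ n) ≡ false
  ≢⇒≡ᵇ-false {m} {n} m≢n with m ≡ᵇ n in eq
  ... | true  = ⊥-elim (m≢n (≡ᵇ-true⇒≡ eq))
  ... | false = refl

  swap : ℕ → ℕ → ℕ → ℕ
  swap a b i = if i ≡ᵇ a then b else (if i ≡ᵇ b then a else i)

  swap-a : ∀ a b → swap a b a ≡ b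
  swap-a a b rewrite ≡ᵇ-refl a = refl

  swap-b : ∀ {a b} → a ≢ b → swap a b b ≡ a
  swap-b {a} {b} a≢b rewrite ≢⇒≡ᵇ-false (a≢b ∘ sym) | ≡ᵇ-refl b = refl

  swap-other : ∀ {a b i} → i ≢ a → i ≢ b → swap a b i ≡ i
  swap-other i≢a i≢b rewrite ≢⇒≡ᵇ-false i≢a | ≢⇒≡ᵇ-false i≢b = refl

  swap-involutive : ∀ a b i → swap a b (swap a b i) ≡ i
  swap-involutive a b i with i ≟ a | i ≟ b
  ... | yes refl | _ with a ≟ b
  ...   | yes refl = trans (cong (swap a a) (swap-a a a)) (swap-a a a)
  ...   | no a≢b   = trans (cong (swap a b) (swap-a a b)) (swap-b a≢b)
  swap-involutive a b i | no i≢a | yes refl = trans (cong (swap a i) (swap-b (i≢a ∘ sym))) (swap-a a i)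
  swap-involutive a b i | no i≢a | no i≢b   = trans (cong (swap a b) (swap-other i≢a i≢b)) (swap-other i≢a i≢b)

  swap-injective : ∀ a b {i j} → swap a b i ≡ swap a b j → i ≡ j
  swap-injective a b {i} {j} eq = trans (sym (swap-involutive a b i)) (trans (cong (swap a b) eq) (swap-involutive a b j))

  swap-≡ᵇ : ∀ a b i j → (swap a b i ≡ᵇ swap a b j) ≡ (i ≡ᵇ j)
  swap-≡ᵇ a b i j with i ≟ j
  ... | yes refl = trans (≡ᵇ-refl (swap a b i)) (sym (≡ᵇ-refl i))
  ... | no i≢j   = trans (≢⇒≡ᵇ-false (i≢j ∘ swap-injective a b)) (sym (≢⇒≡ᵇ-false i≢j))

  ∑-upTo-pick₂ : ∀ {m a b} → a ≢ b → a < m → b < m → (g : ℕ → ℕ) →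
    ∑ (upTo m) g ≡ g a + (g b + ∑ (upTo m) (λ i → if (i ≡ᵇ a) ∨ (i ≡ᵇ b) then 0 else g i))
  ∑-upTo-pick₂ {m} {a} {b} a≢b a<m b<m g = begin
    ∑ (upTo m) g
      ≡⟨ ∑-cong (upTo m) split ⟩
    ∑ (upTo m) (λ i → at a i + (at b i + rest i))
      ≡⟨ trans (∑-distrib-+ (upTo m) (at a) _) (cong (∑ (upTo m) (at a) +_) (∑-distrib-+ (upTo m) (at b) rest)) ⟩
    ∑ (upTo m) (at a) + (∑ (upTo m) (at b) + ∑ (upTo m) rest)
      ≡⟨ cong₂ (λ x y → x + (y + ∑ (upTo m) rest)) (∑-upTo-select g a<m) (∑-upTo-select g b<m) ⟩
    g a + (g b + ∑ (upTo m) rest) ∎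
    where
    open ≡-Reasoning
    at : ℕ → ℕ → ℕ
    at y i = if i ≡ᵇ y then g i else 0
    rest : ℕ → ℕ
    rest i = if (i ≡ᵇ a) ∨ (i ≡ᵇ b) then 0 else g i
    split : ∀ i → g i ≡ at a i + (at b i + rest i)
    split i with i ≡ᵇ a in ia | i ≡ᵇ b in ib
    ... | true  | true  = ⊥-elim (a≢b (trans (sym (≡ᵇ-true⇒≡ {i} {a} ia)) (≡ᵇ-true⇒≡ {i} {b} ib)))
    ... | true  | false = sym (+-identityʳ (g i))
    ... | false | true  = sym (+-identityʳ (g i))
    ... | false | false = refl

  ∑-upTo-swap : ∀ {m a b} → a < m → b < m → (g : ℕ → ℕ) → ∑ (upTo m) (λ i → g (swap a b i)) ≡ ∑ (upTo m) g
  ∑-upTo-swap {m} {a} {b} a<m b<m g with a ≟ b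
  ... | yes refl = ∑-cong (upTo m) (λ i → cong g (swap-same i))
    where
    swap-same : ∀ i → swap a a i ≡ i
    swap-same i with i ≡ᵇ a in ia
    ... | true  = sym (≡ᵇ-true⇒≡ ia)
    ... | false = refl
  ... | no a≢b = begin
    ∑ (upTo m) (g ∘ swap a b)
      ≡⟨ ∑-upTo-pick₂ a≢b a<m b<m (g ∘ swap a b) ⟩
    g (swap a b a) + (g (swap a b b) + ∑ (upTo m) (λ i → if (i ≡ᵇ a) ∨ (i ≡ᵇ b) then 0 else g (swap a b i)))
      ≡⟨ cong₂ (λ x y → g x + (g y + Rswap)) (swap-a a b) (swap-b a≢b) ⟩
    g b + (g a + ∑ (upTo m) (λ i → if (i ≡ᵇ a) ∨ (i ≡ᵇ b) then 0 else g (swap a b i)))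
      ≡⟨ cong (λ s → g b + (g a + s)) (∑-cong (upTo m) rest-fixed) ⟩
    g b + (g a + R)
      ≡⟨ x∙yz≈y∙xz (g b) (g a) R ⟩
    g a + (g b + R)
      ≡⟨ ∑-upTo-pick₂ a≢b a<m b<m g ⟨
    ∑ (upTo m) g ∎
    where
    open ≡-Reasoning
    Rswap R : ℕ
    Rswap = ∑ (upTo m) (λ i → if (i ≡ᵇ a) ∨ (i ≡ᵇ b) then 0 else g (swap a b i))
    R = ∑ (upTo m) (λ i → if (i ≡ᵇ a) ∨ (i ≡ᵇ b) then 0 else g i)
    rest-fixed : ∀ i → (if (i ≡ᵇ a) ∨ (i ≡ᵇ b) then 0 else g (swap a b i)) ≡ (if (i ≡ᵇ a) ∨ (i ≡ᵇ b) then 0 else g i)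
    rest-fixed i with i ≡ᵇ a | i ≡ᵇ b
    ... | true  | _     = refl
    ... | false | true  = refl
    ... | false | false = refl

  fallingℕ : ℕ → ℕ → ℕ
  fallingℕ m zero    = 1
  fallingℕ m (suc k) = fallingℕ m k * (m ∸ k)

  fallingℕ-zero : ∀ {m k} → m < k → fallingℕ m k ≡ 0
  fallingℕ-zero {m} {suc k} (s≤s m≤k) with m≤n⇒m<n∨m≡n m≤k
  ... | inj₁ m<k  rewrite fallingℕ-zero m<k = refl
  ... | inj₂ refl rewrite n∸n≡0 m = *-zeroʳ (fallingℕ m m)

  fallingℕ-nonZero : ∀ {m k} → k ≤ m → NonZero (fallingℕ m k)
  fallingℕ-nonZero {m} {zero}  _    = _
  fallingℕ-nonZero {m} {suc k} k<m  =
    m*n≢0 (fallingℕ m k) (m ∸ k) {{fallingℕ-nonZero (<⇒≤ k<m)}} {{>-nonZero (m<n⇒0<n∸m k<m)}}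

  colourings : ℕ → (n : ℕ) → List (Vec ℕ n)
  colourings m zero    = [] ∷ []
  colourings m (suc n) = concatMap (λ f → map (_∷ f) (upTo m)) (colourings m n)

  Bounded : ℕ → ∀ {n} → Vec ℕ n → Set
  Bounded m f = ∀ v → Vec.lookup f v < m

  ∷-bounded : ∀ {m n i} {f : Vec ℕ n} → i < m → Bounded m f → Bounded m (i ∷ f)
  ∷-bounded i<m bf zero    = i<m
  ∷-bounded i<m bf (suc v) = bf v

  colourings-bounded : ∀ m n → All (Bounded m) (colourings m n)
  colourings-bounded m zero    = (λ ()) ∷ []
  colourings-bounded m (suc n) = All.concat⁺ (All.map⁺ (All.map extend (colourings-bounded m n)))
    where
    extend : ∀ {f} → Bounded m f → All (Bounded m) (map (_∷ f) (upTo m))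
    extend bf = All.map⁺ (All.map (λ i<m → ∷-bounded i<m bf) (upTo-bounded m))

  rgs-bounded : ∀ n → All (λ ck → Bounded (proj₂ ck) (proj₁ ck)) (rgs n)
  rgs-bounded zero    = (λ ()) ∷ []
  rgs-bounded (suc n) = All.concat⁺ (All.map⁺ (All.map extend (rgs-bounded n)))
    where
    extend : ∀ {ck} → Bounded (proj₂ ck) (proj₁ ck) →
      All (λ ck → Bounded (proj₂ ck) (proj₁ ck)) (map (λ j → (j ∷ proj₁ ck) , (proj₂ ck ⊔ suc j)) (upTo (suc (proj₂ ck))))
    extend {c , k} bc = All.map⁺ (All.map (λ {j} _ → ∷-bounded (m≤n⊔m k (suc j)) (λ v → <-≤-trans (bc v) (m≤m⊔n k (suc j))))
                                          (upTo-bounded (suc k)))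

  ∑-colourings-suc : ∀ m n (H : Vec ℕ (suc n) → ℕ) →
    ∑ (colourings m (suc n)) H ≡ ∑ (colourings m n) (λ f → ∑ (upTo m) (λ i → H (i ∷ f)))
  ∑-colourings-suc m n H = trans (∑-concatMap (λ f → map (_∷ f) (upTo m)) (colourings m n) H)
                                 (∑-cong (colourings m n) (λ f → ∑-map (_∷ f) (upTo m) H))

  ∑-colourings-insertAt : ∀ m n (b : Fin (suc n)) (H : Vec ℕ (suc n) → ℕ) →
    ∑ (colourings m (suc n)) H ≡ ∑ (colourings m n) (λ g → ∑ (upTo m) (λ i → H (Vec.insertAt g b i)))
  ∑-colourings-insertAt m n       zero    H = ∑-colourings-suc m n H
  ∑-colourings-insertAt m (suc n) (suc b) H = begin
    ∑ (colourings m (suc (suc n))) H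
      ≡⟨ ∑-colourings-suc m (suc n) H ⟩
    ∑ (colourings m (suc n)) (λ f → ∑ (upTo m) (λ x → H (x ∷ f)))
      ≡⟨ ∑-colourings-insertAt m n b _ ⟩
    ∑ (colourings m n) (λ g → ∑ (upTo m) (λ i → ∑ (upTo m) (λ x → H (x ∷ Vec.insertAt g b i))))
      ≡⟨ ∑-cong (colourings m n) (λ g → ∑-comm (upTo m) (upTo m) (λ i x → H (x ∷ Vec.insertAt g b i))) ⟩
    ∑ (colourings m n) (λ g → ∑ (upTo m) (λ x → ∑ (upTo m) (λ i → H (x ∷ Vec.insertAt g b i))))
      ≡⟨ ∑-colourings-suc m n (λ g → ∑ (upTo m) (λ i → H (Vec.insertAt g (suc b) i))) ⟨
    ∑ (colourings m (suc n)) (λ g → ∑ (upTo m) (λ i → H (Vec.insertAt g (suc b) i))) ∎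
    where open ≡-Reasoning

  -- Reduction of colourings to partitions

  ColourInvariant : ℕ → ∀ {n} → (Vec ℕ n → ℕ) → Set
  ColourInvariant m {n} H = ∀ {a b} → a < m → b < m → ∀ (f : Vec ℕ n) → H (Vec.map (swap a b) f) ≡ H f

  map-swap-unused : ∀ {n k a b} (c : Vec ℕ n) → Bounded k c → k ≤ a → k ≤ b → Vec.map (swap a b) c ≡ c
  map-swap-unused []      bc k≤a k≤b = refl
  map-swap-unused (x ∷ c) bc k≤a k≤b =
    cong₂ _∷_ (swap-other (<⇒≢ (<-≤-trans (bc zero) k≤a)) (<⇒≢ (<-≤-trans (bc zero) k≤b)))
              (map-swap-unused c (bc ∘ suc) k≤a k≤b)

  -- By colour invariance every colour not used by c behaves like the first unused colour k.
  ∑-fresh-colours : ∀ {n m k} (c : Vec ℕ n) → Bounded k c → k ≤ m → (H : Vec ℕ (suc n) → ℕ) → ColourInvariant m H →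
    ∑ (upTo m) (λ i → H (i ∷ c)) ≡ ∑ (upTo k) (λ j → H (j ∷ c)) + (m ∸ k) * H (k ∷ c)
  ∑-fresh-colours {m = m} {k} c bc k≤m H invH = begin
    ∑ (upTo m) (λ i → H (i ∷ c))
      ≡⟨ cong (λ l → ∑ (upTo l) (λ i → H (i ∷ c))) (m+[n∸m]≡n k≤m) ⟨
    ∑ (upTo (k + (m ∸ k))) (λ i → H (i ∷ c))
      ≡⟨ ∑-upTo-+ k (m ∸ k) (λ i → H (i ∷ c)) ⟩
    ∑ (upTo k) (λ j → H (j ∷ c)) + ∑ (upTo (m ∸ k)) (λ i → H ((k + i) ∷ c))
      ≡⟨ cong (∑ (upTo k) (λ j → H (j ∷ c)) +_) (∑-cong-All (upTo-bounded (m ∸ k)) fresh) ⟩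
    ∑ (upTo k) (λ j → H (j ∷ c)) + ∑ (upTo (m ∸ k)) (λ _ → H (k ∷ c))
      ≡⟨ cong (∑ (upTo k) (λ j → H (j ∷ c)) +_) (∑-upTo-const (m ∸ k) (H (k ∷ c))) ⟩
    ∑ (upTo k) (λ j → H (j ∷ c)) + (m ∸ k) * H (k ∷ c) ∎
    where
    open ≡-Reasoning
    fresh : ∀ {i} → i < m ∸ k → H ((k + i) ∷ c) ≡ H (k ∷ c)
    fresh {i} i<m∸k = begin
      H ((k + i) ∷ c)
        ≡⟨ cong₂ (λ x y → H (x ∷ y)) (swap-a k (k + i)) (map-swap-unused c bc ≤-refl (m≤m+n k i)) ⟨
      H (Vec.map (swap k (k + i)) (k ∷ c))
        ≡⟨ invH (≤-<-trans (m≤m+n k i) k+i<m) k+i<m (k ∷ c) ⟩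
      H (k ∷ c) ∎
      where
      k+i<m : k + i < m
      k+i<m = subst (k + i <_) (m+[n∸m]≡n k≤m) (+-monoʳ-< k i<m∸k)

  fallingℕ*∑-head≡∑-extensions : ∀ {n} m k (c : Vec ℕ n) → Bounded k c →
    (H : Vec ℕ (suc n) → ℕ) → ColourInvariant m H →
    fallingℕ m k * ∑ (upTo m) (λ i → H (i ∷ c)) ≡ ∑ (upTo (suc k)) (λ j → fallingℕ m (k ⊔ suc j) * H (j ∷ c))
  fallingℕ*∑-head≡∑-extensions m k c bc H invH with k ≤? m
  ... | no k≰m rewrite fallingℕ-zero (≰⇒> k≰m) =
    sym (∑-zero (upTo (suc k)) (λ j → cong (_* H (j ∷ c)) (fallingℕ-zero (<-≤-trans (≰⇒> k≰m) (m≤m⊔n k (suc j))))))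
  ... | yes k≤m = sym (begin
    ∑ (upTo (suc k)) (λ j → fallingℕ m (k ⊔ suc j) * H (j ∷ c))
      ≡⟨ ∑-upTo-sucʳ k _ ⟩
    ∑ (upTo k) (λ j → fallingℕ m (k ⊔ suc j) * H (j ∷ c)) + fallingℕ m (k ⊔ suc k) * H (k ∷ c)
      ≡⟨ cong₂ _+_ (∑-cong-All (upTo-bounded k) (λ j<k → cong (λ l → fallingℕ m l * H (_ ∷ c)) (m≥n⇒m⊔n≡m j<k)))
                   (cong (λ l → fallingℕ m l * H (k ∷ c)) (m≤n⇒m⊔n≡n (n≤1+n k))) ⟩
    ∑ (upTo k) (λ j → fallingℕ m k * H (j ∷ c)) + fallingℕ m k * (m ∸ k) * H (k ∷ c)
      ≡⟨ cong₂ _+_ (*-distribˡ-∑ (fallingℕ m k) (upTo k) (λ j → H (j ∷ c)))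
                   (sym (*-assoc (fallingℕ m k) (m ∸ k) (H (k ∷ c)))) ⟨
    fallingℕ m k * ∑ (upTo k) (λ j → H (j ∷ c)) + fallingℕ m k * ((m ∸ k) * H (k ∷ c))
      ≡⟨ *-distribˡ-+ (fallingℕ m k) _ _ ⟨
    fallingℕ m k * (∑ (upTo k) (λ j → H (j ∷ c)) + (m ∸ k) * H (k ∷ c))
      ≡⟨ cong (fallingℕ m k *_) (∑-fresh-colours c bc k≤m H invH) ⟨
    fallingℕ m k * ∑ (upTo m) (λ i → H (i ∷ c)) ∎)
    where open ≡-Reasoning

  ColourInvariant-∑-head : ∀ {m n} (H : Vec ℕ (suc n) → ℕ) → ColourInvariant m H →
    ColourInvariant m (λ (f : Vec ℕ n) → ∑ (upTo m) (λ i → H (i ∷ f)))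
  ColourInvariant-∑-head {m} H invH {a} {b} a<m b<m f = begin
    ∑ (upTo m) (λ i → H (i ∷ Vec.map (swap a b) f))
      ≡⟨ ∑-upTo-swap a<m b<m (λ i → H (i ∷ Vec.map (swap a b) f)) ⟨
    ∑ (upTo m) (λ i → H (Vec.map (swap a b) (i ∷ f)))
      ≡⟨ ∑-cong (upTo m) (λ i → invH a<m b<m (i ∷ f)) ⟩
    ∑ (upTo m) (λ i → H (i ∷ f)) ∎
    where open ≡-Reasoning

  ∑-colourings≡∑-partitions : ∀ n m (H : Vec ℕ n → ℕ) → ColourInvariant m H →
    ∑ (colourings m n) H ≡ ∑ (rgs n) (λ ck → fallingℕ m (proj₂ ck) * H (proj₁ ck))
  ∑-colourings≡∑-partitions zero    m H invH = cong (_+ 0) (sym (+-identityʳ (H [])))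
  ∑-colourings≡∑-partitions (suc n) m H invH = begin
    ∑ (colourings m (suc n)) H
      ≡⟨ ∑-colourings-suc m n H ⟩
    ∑ (colourings m n) H′
      ≡⟨ ∑-colourings≡∑-partitions n m H′ (ColourInvariant-∑-head H invH) ⟩
    ∑ (rgs n) (λ ck → fallingℕ m (proj₂ ck) * H′ (proj₁ ck))
      ≡⟨ ∑-cong-All (rgs-bounded n) (λ {ck} bc → fallingℕ*∑-head≡∑-extensions m (proj₂ ck) (proj₁ ck) bc H invH) ⟩
    ∑ (rgs n) (λ ck → ∑ (upTo (suc (proj₂ ck))) (λ j → fallingℕ m (proj₂ ck ⊔ suc j) * H (j ∷ proj₁ ck)))
      ≡⟨ ∑-cong (rgs n) (λ ck → ∑-map _ (upTo (suc (proj₂ ck))) weight) ⟨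
    ∑ (rgs n) (λ ck → ∑ (extend ck) weight)
      ≡⟨ ∑-concatMap extend (rgs n) weight ⟨
    ∑ (rgs (suc n)) weight ∎
    where
    open ≡-Reasoning
    H′ : Vec ℕ n → ℕ
    H′ f = ∑ (upTo m) (λ i → H (i ∷ f))
    extend : Vec ℕ n × ℕ → List (Vec ℕ (suc n) × ℕ)
    extend ck = map (λ j → (j ∷ proj₁ ck) , (proj₂ ck ⊔ suc j)) (upTo (suc (proj₂ ck)))
    weight : Vec ℕ (suc n) × ℕ → ℕ
    weight ck = fallingℕ m (proj₂ ck) * H (proj₁ ck)

  punchIn-fromℕ : ∀ {n} (v : Fin n) → punchIn (fromℕ n) v ≡ inject₁ v
  punchIn-fromℕ zero    = refl
  punchIn-fromℕ (suc v) = cong suc (punchIn-fromℕ v)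

  inject₁≢fromℕ : ∀ {n} (u : Fin n) → inject₁ u ≢ fromℕ n
  inject₁≢fromℕ u = Fin.fromℕ≢inject₁ ∘ sym

  punchIn-inject₁ : ∀ {n} (i : Fin (suc n)) (k : Fin n) → punchIn (inject₁ i) (inject₁ k) ≡ inject₁ (punchIn i k)
  punchIn-inject₁ zero    k       = refl
  punchIn-inject₁ (suc i) zero    = refl
  punchIn-inject₁ (suc i) (suc k) = cong suc (punchIn-inject₁ i k)

  punchIn-inject₁-fromℕ : ∀ {n} (i : Fin (suc n)) → punchIn (inject₁ i) (fromℕ n) ≡ fromℕ (suc n)
  punchIn-inject₁-fromℕ         zero    = refl
  punchIn-inject₁-fromℕ {suc n} (suc i) = cong suc (punchIn-inject₁-fromℕ i)

  relabel : ∀ {n k} → (Fin n → Fin k) → List (Fin n × Fin n) → List (Fin k × Fin k)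
  relabel σ = map (λ p → σ (proj₁ p) , σ (proj₂ p))

  proper-relabel : ∀ {n k} (c : Vec ℕ n) (d : Vec ℕ k) (σ : Fin n → Fin k) →
    (∀ u → Vec.lookup c u ≡ Vec.lookup d (σ u)) → ∀ E → proper c E ≡ proper d (relabel σ E)
  proper-relabel c d σ c≗d∘σ []            = refl
  proper-relabel c d σ c≗d∘σ ((u , v) ∷ E)
    rewrite c≗d∘σ u | c≗d∘σ v | proper-relabel c d σ c≗d∘σ E = refl

  proper-swap : ∀ {n} a b (f : Vec ℕ n) E → proper (Vec.map (swap a b) f) E ≡ proper f E
  proper-swap a b f []            = refl
  proper-swap a b f ((u , v) ∷ E)
    rewrite Vec.lookup-map u (swap a b) f | Vec.lookup-map v (swap a b) f
          | swap-≡ᵇ a b (Vec.lookup f u) (Vec.lookup f v) | proper-swap a b f E = refl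

  lookup-insertAt-last : ∀ {n} (g : Vec ℕ n) i u → Vec.lookup (Vec.insertAt g (fromℕ n) i) (inject₁ u) ≡ Vec.lookup g u
  lookup-insertAt-last {n} g i u =
    trans (cong (Vec.lookup (Vec.insertAt g (fromℕ n) i)) (sym (punchIn-fromℕ u))) (Vec.insertAt-punchIn g (fromℕ n) i u)

  proper-insertAt-last : ∀ {n} (g : Vec ℕ n) i E → proper (Vec.insertAt g (fromℕ n) i) (map injE E) ≡ proper g E
  proper-insertAt-last g i E = sym (proper-relabel g _ inject₁ (sym ∘ lookup-insertAt-last g i) E)

  properColourings : ℕ → Graph → ℕ
  properColourings m (graph n E) = ∑ (colourings m n) (λ f → 𝟙 (proper f E))

  properColouringsAgreeing : ℕ → (G : Graph) → (a b : Fin (Graph.n G)) → ℕ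
  properColouringsAgreeing m (graph n E) a b =
    ∑ (colourings m n) (λ f → 𝟙 (proper f E) * 𝟙 (Vec.lookup f a ≡ᵇ Vec.lookup f b))

  properColouringsAgreeing-refl : ∀ m G a → properColouringsAgreeing m G a a ≡ properColourings m G
  properColouringsAgreeing-refl m (graph n E) a = ∑-cong (colourings m n) λ f →
    trans (cong (λ β → 𝟙 (proper f E) * 𝟙 β) (≡ᵇ-refl (Vec.lookup f a))) (*-identityʳ _)

  properColourings-∷ : ∀ m {n} (a b : Fin n) E →
    properColourings m (graph n ((a , b) ∷ E)) + properColouringsAgreeing m (graph n E) a b ≡ properColourings m (graph n E)
  properColourings-∷ m {n} a b E = trans (sym (∑-distrib-+ (colourings m n) _ _)) (∑-cong (colourings m n) split)
    where
    split : ∀ f → 𝟙 (not (Vec.lookup f a ≡ᵇ Vec.lookup f b) ∧ proper f E)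
                    + 𝟙 (proper f E) * 𝟙 (Vec.lookup f a ≡ᵇ Vec.lookup f b) ≡ 𝟙 (proper f E)
    split f with Vec.lookup f a ≡ᵇ Vec.lookup f b | proper f E
    ... | true  | true  = refl
    ... | true  | false = refl
    ... | false | true  = refl
    ... | false | false = refl

  -- Falling-factorial expansions

  blockCounts : Graph → List ℕ
  blockCounts (graph n E) = map proj₂ (filterᵇ (λ ck → proper (proj₁ ck) E) (rgs n))

  properColourings≡∑-blockCounts : ∀ m G → properColourings m G ≡ ∑ (blockCounts G) (fallingℕ m)
  properColourings≡∑-blockCounts m (graph n E) = begin
    properColourings m (graph n E)
      ≡⟨ ∑-colourings≡∑-partitions n m (λ f → 𝟙 (proper f E)) (λ {a} {b} _ _ f → cong 𝟙 (proper-swap a b f E)) ⟩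
    ∑ (rgs n) (λ ck → fallingℕ m (proj₂ ck) * 𝟙 (proper (proj₁ ck) E))
      ≡⟨ ∑-cong (rgs n) (λ ck → *-𝟙 (fallingℕ m (proj₂ ck)) (proper (proj₁ ck) E)) ⟩
    ∑ (rgs n) (λ ck → if proper (proj₁ ck) E then fallingℕ m (proj₂ ck) else 0)
      ≡⟨ ∑-filterᵇ _ (rgs n) (fallingℕ m ∘ proj₂) ⟨
    ∑ (filterᵇ (λ ck → proper (proj₁ ck) E) (rgs n)) (fallingℕ m ∘ proj₂)
      ≡⟨ ∑-map proj₂ (filterᵇ (λ ck → proper (proj₁ ck) E) (rgs n)) (fallingℕ m) ⟨
    ∑ (blockCounts (graph n E)) (fallingℕ m) ∎
    where
    open ≡-Reasoning
    *-𝟙 : ∀ x β → x * 𝟙 β ≡ (if β then x else 0)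
    *-𝟙 x true  = *-identityʳ x
    *-𝟙 x false = *-zeroʳ x

  -- x · x⁽ᵏ⁾ = x⁽ᵏ⁺¹⁾ + k · x⁽ᵏ⁾, with k · x⁽ᵏ⁾ written as k copies of x⁽ᵏ⁾.
  timesX : List ℕ → List ℕ
  timesX = concatMap (λ k → suc k ∷ replicate k k)

  ∑-replicate : ∀ k j (f : ℕ → ℕ) → ∑ (replicate k j) f ≡ k * f j
  ∑-replicate zero    j f = refl
  ∑-replicate (suc k) j f = cong (f j +_) (∑-replicate k j f)

  *-fallingℕ : ∀ m k → m * fallingℕ m k ≡ fallingℕ m (suc k) + k * fallingℕ m k
  *-fallingℕ m k with k ≤? m
  ... | no k≰m  rewrite fallingℕ-zero (≰⇒> k≰m) | *-zeroʳ m | *-zeroʳ k = refl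
  ... | yes k≤m = begin
    m * fallingℕ m k                                    ≡⟨ cong (_* fallingℕ m k) (m∸n+n≡m k≤m) ⟨
    (m ∸ k + k) * fallingℕ m k                          ≡⟨ *-distribʳ-+ (fallingℕ m k) (m ∸ k) k ⟩
    (m ∸ k) * fallingℕ m k + k * fallingℕ m k           ≡⟨ cong (_+ k * fallingℕ m k) (*-comm (m ∸ k) (fallingℕ m k)) ⟩
    fallingℕ m (suc k) + k * fallingℕ m k               ∎
    where open ≡-Reasoning

  ∑-timesX : ∀ m L → ∑ (timesX L) (fallingℕ m) ≡ m * ∑ L (fallingℕ m)
  ∑-timesX m L = begin
    ∑ (timesX L) (fallingℕ m)
      ≡⟨ ∑-concatMap _ L (fallingℕ m) ⟩
    ∑ L (λ k → fallingℕ m (suc k) + ∑ (replicate k k) (fallingℕ m))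
      ≡⟨ ∑-cong L (λ k → trans (cong (fallingℕ m (suc k) +_) (∑-replicate k k (fallingℕ m))) (sym (*-fallingℕ m k))) ⟩
    ∑ L (λ k → m * fallingℕ m k)
      ≡⟨ *-distribˡ-∑ m L (fallingℕ m) ⟨
    m * ∑ L (fallingℕ m) ∎
    where open ≡-Reasoning

  multiplicity : ℕ → List ℕ → ℕ
  multiplicity k L = ∑ L (λ j → 𝟙 (j ≡ᵇ k))

  ∑-fallingℕ-by-multiplicity : ∀ k L → ∑ L (fallingℕ k) ≡ ∑ (upTo (suc k)) (λ j → multiplicity j L * fallingℕ k j)
  ∑-fallingℕ-by-multiplicity k []      = sym (∑-zero (upTo (suc k)) (λ _ → refl))
  ∑-fallingℕ-by-multiplicity k (y ∷ L) = begin
    fallingℕ k y + ∑ L (fallingℕ k)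
      ≡⟨ cong₂ _+_ single (∑-fallingℕ-by-multiplicity k L) ⟩
    ∑ (upTo (suc k)) (λ j → 𝟙 (y ≡ᵇ j) * fallingℕ k j) + ∑ (upTo (suc k)) (λ j → multiplicity j L * fallingℕ k j)
      ≡⟨ ∑-distrib-+ (upTo (suc k)) (λ j → 𝟙 (y ≡ᵇ j) * fallingℕ k j) (λ j → multiplicity j L * fallingℕ k j) ⟨
    ∑ (upTo (suc k)) (λ j → 𝟙 (y ≡ᵇ j) * fallingℕ k j + multiplicity j L * fallingℕ k j)
      ≡⟨ ∑-cong (upTo (suc k)) (λ j → *-distribʳ-+ (fallingℕ k j) (𝟙 (y ≡ᵇ j)) (multiplicity j L)) ⟨
    ∑ (upTo (suc k)) (λ j → multiplicity j (y ∷ L) * fallingℕ k j) ∎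
    where
    open ≡-Reasoning
    indicator : ∀ j → 𝟙 (y ≡ᵇ j) * fallingℕ k j ≡ (if j ≡ᵇ y then fallingℕ k j else 0)
    indicator j rewrite ≡ᵇ-sym y j with j ≡ᵇ y
    ... | true  = +-identityʳ _
    ... | false = refl
    single : fallingℕ k y ≡ ∑ (upTo (suc k)) (λ j → 𝟙 (y ≡ᵇ j) * fallingℕ k j)
    single with y <? suc k
    ... | yes y<1+k = trans (sym (∑-upTo-select (fallingℕ k) y<1+k)) (sym (∑-cong (upTo (suc k)) indicator))
    ... | no  y≮1+k = trans (fallingℕ-zero (≮⇒≥ y≮1+k))
                            (sym (trans (∑-cong (upTo (suc k)) indicator) (∑-upTo-select-≥ (fallingℕ k) (≮⇒≥ y≮1+k))))

  -- Evaluating at m = j isolates index j: larger indices vanish there, smaller ones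
  -- have equal multiplicities by induction, and j⁽ʲ⁾ = j! ≠ 0.
  multiplicity-unique : ∀ L₁ L₂ → (∀ m → ∑ L₁ (fallingℕ m) ≡ ∑ L₂ (fallingℕ m)) →
    ∀ k → multiplicity k L₁ ≡ multiplicity k L₂
  multiplicity-unique L₁ L₂ same k = below (suc k) ≤-refl
    where
    below : ∀ K {j} → j < K → multiplicity j L₁ ≡ multiplicity j L₂
    below (suc K) {j} (s≤s j≤K) with m≤n⇒m<n∨m≡n j≤K
    ... | inj₁ j<K  = below K j<K
    ... | inj₂ refl =
      *-cancelʳ-≡ (multiplicity j L₁) (multiplicity j L₂) (fallingℕ j j) {{fallingℕ-nonZero (≤-refl {j})}}
                  (+-cancelˡ-≡ (lower L₁) _ _ (begin
        lower L₁ + multiplicity j L₁ * fallingℕ j j                 ≡⟨ ∑-upTo-sucʳ j _ ⟨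
        ∑ (upTo (suc j)) (λ i → multiplicity i L₁ * fallingℕ j i)   ≡⟨ ∑-fallingℕ-by-multiplicity j L₁ ⟨
        ∑ L₁ (fallingℕ j)                                           ≡⟨ same j ⟩
        ∑ L₂ (fallingℕ j)                                           ≡⟨ ∑-fallingℕ-by-multiplicity j L₂ ⟩
        ∑ (upTo (suc j)) (λ i → multiplicity i L₂ * fallingℕ j i)   ≡⟨ ∑-upTo-sucʳ j _ ⟩
        lower L₂ + multiplicity j L₂ * fallingℕ j j                 ≡⟨ cong (_+ _) lower-agree ⟨
        lower L₁ + multiplicity j L₂ * fallingℕ j j                 ∎))
      where
      open ≡-Reasoning
      lower : List ℕ → ℕ
      lower L = ∑ (upTo j) (λ i → multiplicity i L * fallingℕ j i)
      lower-agree : lower L₁ ≡ lower L₂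
      lower-agree = ∑-cong-All (upTo-bounded j) (λ {i} i<j → cong (_* fallingℕ j i) (below j i<j))

  -- Polynomial expressions in chromatic polynomials

  infixl 6 _⊕_
  data ChromaticExpr : Set where
    χ   : Graph → ChromaticExpr
    _⊕_ : ChromaticExpr → ChromaticExpr → ChromaticExpr
    X·_ : ChromaticExpr → ChromaticExpr

  evalℕ : ChromaticExpr → ℕ → ℕ
  evalℕ (χ G)     m = properColourings m G
  evalℕ (e₁ ⊕ e₂) m = evalℕ e₁ m + evalℕ e₂ m
  evalℕ (X· e)    m = m * evalℕ e m

  fallingExpansion : ChromaticExpr → List ℕ
  fallingExpansion (χ G)     = blockCounts G
  fallingExpansion (e₁ ⊕ e₂) = fallingExpansion e₁ ++ fallingExpansion e₂
  fallingExpansion (X· e)    = timesX (fallingExpansion e)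

  evalℕ≡∑-fallingExpansion : ∀ e m → evalℕ e m ≡ ∑ (fallingExpansion e) (fallingℕ m)
  evalℕ≡∑-fallingExpansion (χ G)     m = properColourings≡∑-blockCounts m G
  evalℕ≡∑-fallingExpansion (e₁ ⊕ e₂) m =
    trans (cong₂ _+_ (evalℕ≡∑-fallingExpansion e₁ m) (evalℕ≡∑-fallingExpansion e₂ m))
          (sym (∑-++ (fallingExpansion e₁) (fallingExpansion e₂) (fallingℕ m)))
  evalℕ≡∑-fallingExpansion (X· e)    m =
    trans (cong (m *_) (evalℕ≡∑-fallingExpansion e m)) (sym (∑-timesX m (fallingExpansion e)))

  mergeV-punchIn : ∀ {n} {a b v : Fin (suc n)} (a≢b : a ≢ b) → v ≢ b → punchIn b (mergeV a b a≢b v) ≡ v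
  mergeV-punchIn {b = b} {v} a≢b v≢b with v Fin.≟ b
  ... | yes v≡b = ⊥-elim (v≢b v≡b)
  ... | no _    = Fin.punchIn-punchOut _

  mergeV-b : ∀ {n} {a b : Fin (suc n)} (a≢b : a ≢ b) → mergeV a b a≢b b ≡ mergeV a b a≢b a
  mergeV-b {a = a} {b} a≢b with b Fin.≟ b | a Fin.≟ b
  ... | no b≢b | _       = ⊥-elim (b≢b refl)
  ... | yes _  | yes a≡b = ⊥-elim (a≢b a≡b)
  ... | yes _  | no _    = Fin.punchOut-cong b refl

  mergeV-unique : ∀ {n} {a b v : Fin (suc n)} {j} (a≢b : a ≢ b) → v ≢ b → punchIn b j ≡ v → mergeV a b a≢b v ≡ j
  mergeV-unique {b = b} a≢b v≢b eq = Fin.punchIn-injective b _ _ (trans (mergeV-punchIn a≢b v≢b) (sym eq))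

  lookup-insertAt-mergeV : ∀ {n} {a b : Fin (suc n)} (a≢b : a ≢ b) (g : Vec ℕ n) (x : ℕ) {u} → u ≢ b →
    Vec.lookup (Vec.insertAt g b x) u ≡ Vec.lookup g (mergeV a b a≢b u)
  lookup-insertAt-mergeV {a = a} {b} a≢b g x {u} u≢b = begin
    Vec.lookup (Vec.insertAt g b x) u                               ≡⟨ cong (Vec.lookup (Vec.insertAt g b x)) (mergeV-punchIn a≢b u≢b) ⟨
    Vec.lookup (Vec.insertAt g b x) (punchIn b (mergeV a b a≢b u)) ≡⟨ Vec.insertAt-punchIn g b x _ ⟩
    Vec.lookup g (mergeV a b a≢b u)                                 ∎
    where open ≡-Reasoning

  properColourings-contractNonLoop : ∀ m {n} (a b : Fin n) (a≢b : a ≢ b) E →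
    properColourings m (contractNonLoop a b a≢b E) ≡ properColouringsAgreeing m (graph n E) a b
  properColourings-contractNonLoop m {suc n} a b a≢b E = sym (begin
    properColouringsAgreeing m (graph (suc n) E) a b
      ≡⟨ ∑-colourings-insertAt m n b _ ⟩
    ∑ (colourings m n) (λ g → ∑ (upTo m) (λ i → 𝟙 (proper (ins g i) E) * 𝟙 (Vec.lookup (ins g i) a ≡ᵇ Vec.lookup (ins g i) b)))
      ≡⟨ ∑-cong-All (colourings-bounded m n) (λ {g} bg → trans (∑-cong (upTo m) (agree-at g)) (∑-upTo-select _ (bg a′))) ⟩
    ∑ (colourings m n) (λ g → 𝟙 (proper (ins g (Vec.lookup g a′)) E))
      ≡⟨ ∑-cong (colourings m n) (λ g → cong 𝟙 (proper-relabel _ g (mergeV a b a≢b) (merged g) E)) ⟩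
    properColourings m (contractNonLoop a b a≢b E) ∎)
    where
    open ≡-Reasoning
    ins : Vec ℕ n → ℕ → Vec ℕ (suc n)
    ins g i = Vec.insertAt g b i
    a′ : Fin n
    a′ = mergeV a b a≢b a
    agree-at : ∀ g i → 𝟙 (proper (ins g i) E) * 𝟙 (Vec.lookup (ins g i) a ≡ᵇ Vec.lookup (ins g i) b)
                       ≡ (if i ≡ᵇ Vec.lookup g a′ then 𝟙 (proper (ins g i) E) else 0)
    agree-at g i rewrite lookup-insertAt-mergeV a≢b g i a≢b | Vec.insertAt-lookup g b i | ≡ᵇ-sym (Vec.lookup g a′) i
      with i ≡ᵇ Vec.lookup g a′
    ... | true  = *-identityʳ (𝟙 (proper (ins g i) E))
    ... | false = *-zeroʳ (𝟙 (proper (ins g i) E))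
    merged : ∀ g u → Vec.lookup (ins g (Vec.lookup g a′)) u ≡ Vec.lookup g (mergeV a b a≢b u)
    merged g u = by-cases (u Fin.≟ b)
      where
      by-cases : Dec (u ≡ b) → Vec.lookup (ins g (Vec.lookup g a′)) u ≡ Vec.lookup g (mergeV a b a≢b u)
      by-cases (no u≢b)  = lookup-insertAt-mergeV a≢b g _ u≢b
      by-cases (yes u≡b) = begin
        Vec.lookup (ins g (Vec.lookup g a′)) u ≡⟨ cong (Vec.lookup (ins g _)) u≡b ⟩
        Vec.lookup (ins g (Vec.lookup g a′)) b ≡⟨ Vec.insertAt-lookup g b _ ⟩
        Vec.lookup g a′                        ≡⟨ cong (Vec.lookup g) (trans (cong (mergeV a b a≢b) u≡b) (mergeV-b a≢b)) ⟨
        Vec.lookup g (mergeV a b a≢b u)        ∎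

  -- Adding a vertex of degree one or two

  colours-avoiding₁ : ∀ {m y} → y < m → ∑ (upTo m) (λ i → 𝟙 (not (i ≡ᵇ y))) + 1 ≡ m
  colours-avoiding₁ {m} {y} y<m = begin
    ∑ (upTo m) (λ i → 𝟙 (not (i ≡ᵇ y))) + 1
      ≡⟨ cong (∑ (upTo m) (λ i → 𝟙 (not (i ≡ᵇ y))) +_) (∑-upTo-select (λ _ → 1) y<m) ⟨
    ∑ (upTo m) (λ i → 𝟙 (not (i ≡ᵇ y))) + ∑ (upTo m) (λ i → if i ≡ᵇ y then 1 else 0)
      ≡⟨ ∑-distrib-+ (upTo m) _ _ ⟨
    ∑ (upTo m) (λ i → 𝟙 (not (i ≡ᵇ y)) + (if i ≡ᵇ y then 1 else 0))
      ≡⟨ ∑-cong (upTo m) one ⟩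
    ∑ (upTo m) (λ _ → 1)
      ≡⟨ trans (∑-upTo-const m 1) (*-identityʳ m) ⟩
    m ∎
    where
    open ≡-Reasoning
    one : ∀ i → 𝟙 (not (i ≡ᵇ y)) + (if i ≡ᵇ y then 1 else 0) ≡ 1
    one i with i ≡ᵇ y
    ... | true  = refl
    ... | false = refl

  colours-avoiding₂ : ∀ {m y z} → y < m → z < m →
    ∑ (upTo m) (λ i → 𝟙 (not (y ≡ᵇ i) ∧ not (z ≡ᵇ i))) + 2 ≡ 𝟙 (y ≡ᵇ z) + m
  colours-avoiding₂ {m} {y} {z} y<m z<m = begin
    ∑ (upTo m) avoid + 2
      ≡⟨ cong (λ s → ∑ (upTo m) avoid + s) (cong₂ _+_ (∑-upTo-select (λ _ → 1) y<m) (∑-upTo-select (λ _ → 1) z<m)) ⟨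
    ∑ (upTo m) avoid + (∑ (upTo m) (at y) + ∑ (upTo m) (at z))
      ≡⟨ cong (∑ (upTo m) avoid +_) (∑-distrib-+ (upTo m) (at y) (at z)) ⟨
    ∑ (upTo m) avoid + ∑ (upTo m) (λ i → at y i + at z i)
      ≡⟨ ∑-distrib-+ (upTo m) avoid _ ⟨
    ∑ (upTo m) (λ i → avoid i + (at y i + at z i))
      ≡⟨ ∑-cong (upTo m) count ⟩
    ∑ (upTo m) (λ i → (if i ≡ᵇ y then 𝟙 (i ≡ᵇ z) else 0) + 1)
      ≡⟨ ∑-distrib-+ (upTo m) _ _ ⟩
    ∑ (upTo m) (λ i → if i ≡ᵇ y then 𝟙 (i ≡ᵇ z) else 0) + ∑ (upTo m) (λ _ → 1)
      ≡⟨ cong₂ _+_ (∑-upTo-select (λ i → 𝟙 (i ≡ᵇ z)) y<m) (trans (∑-upTo-const m 1) (*-identityʳ m)) ⟩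
    𝟙 (y ≡ᵇ z) + m ∎
    where
    open ≡-Reasoning
    avoid : ℕ → ℕ
    avoid i = 𝟙 (not (y ≡ᵇ i) ∧ not (z ≡ᵇ i))
    at : ℕ → ℕ → ℕ
    at c i = if i ≡ᵇ c then 1 else 0
    count : ∀ i → avoid i + (at y i + at z i) ≡ (if i ≡ᵇ y then 𝟙 (i ≡ᵇ z) else 0) + 1
    count i rewrite ≡ᵇ-sym y i | ≡ᵇ-sym z i with i ≡ᵇ y | i ≡ᵇ z
    ... | true  | true  = refl
    ... | true  | false = refl
    ... | false | true  = refl
    ... | false | false = refl

  addPendant : (G : Graph) → Fin (Graph.n G) → Graph
  addPendant (graph n E) b = graph (suc n) ((fromℕ n , inject₁ b) ∷ map injE E)

  addCommonNeighbour : (G : Graph) → (a b : Fin (Graph.n G)) → Graph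
  addCommonNeighbour (graph n E) a b = graph (suc n) ((inject₁ a , fromℕ n) ∷ (inject₁ b , fromℕ n) ∷ map injE E)

  properColourings-addPendant : ∀ m G b →
    properColourings m (addPendant G b) + properColourings m G ≡ m * properColourings m G
  properColourings-addPendant m (graph n E) b = begin
    properColourings m (graph (suc n) ((fromℕ n , inject₁ b) ∷ map injE E)) + properColourings m (graph n E)
      ≡⟨ cong (_+ properColourings m (graph n E)) (∑-colourings-insertAt m n (fromℕ n) _) ⟩
    ∑ (colourings m n) (λ g → ∑ (upTo m) (new g)) + ∑ (colourings m n) (λ g → 𝟙 (proper g E))
      ≡⟨ ∑-distrib-+ (colourings m n) _ _ ⟨
    ∑ (colourings m n) (λ g → ∑ (upTo m) (new g) + 𝟙 (proper g E))
      ≡⟨ ∑-cong-All (colourings-bounded m n) (λ {g} bg → count g bg (proper g E) refl) ⟩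
    ∑ (colourings m n) (λ g → m * 𝟙 (proper g E))
      ≡⟨ *-distribˡ-∑ m (colourings m n) _ ⟨
    m * properColourings m (graph n E) ∎
    where
    open ≡-Reasoning
    new : Vec ℕ n → ℕ → ℕ
    new g i = 𝟙 (proper (Vec.insertAt g (fromℕ n) i) ((fromℕ n , inject₁ b) ∷ map injE E))
    new≡ : ∀ g i → new g i ≡ 𝟙 (not (i ≡ᵇ Vec.lookup g b) ∧ proper g E)
    new≡ g i rewrite Vec.insertAt-lookup g (fromℕ n) i | lookup-insertAt-last g i b | proper-insertAt-last g i E = refl
    count : ∀ g → Bounded m g → ∀ p → proper g E ≡ p → ∑ (upTo m) (new g) + 𝟙 p ≡ m * 𝟙 p
    count g bg false eq rewrite ∑-cong (upTo m) (new≡ g) | eq =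
      trans (cong (_+ 0) (∑-zero (upTo m) (λ i → cong 𝟙 (∧-zeroʳ _)))) (sym (*-zeroʳ m))
    count g bg true  eq rewrite ∑-cong (upTo m) (new≡ g) | eq =
      trans (cong (_+ 1) (∑-cong (upTo m) (λ i → cong 𝟙 (∧-identityʳ _))))
            (trans (colours-avoiding₁ (bg b)) (sym (*-identityʳ m)))

  properColourings-addCommonNeighbour : ∀ m G a b →
    properColourings m (addCommonNeighbour G a b) + (properColourings m G + properColourings m G)
      ≡ properColouringsAgreeing m G a b + m * properColourings m G
  properColourings-addCommonNeighbour m (graph n E) a b = begin
    properColourings m (addCommonNeighbour (graph n E) a b) + (N + N)
      ≡⟨ cong₂ _+_ (sym (∑-colourings-insertAt m n (fromℕ n) _)) (∑-distrib-+ (colourings m n) _ _) ⟨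
    ∑ (colourings m n) (λ g → ∑ (upTo m) (new g)) + ∑ (colourings m n) (λ g → 𝟙 (proper g E) + 𝟙 (proper g E))
      ≡⟨ ∑-distrib-+ (colourings m n) _ _ ⟨
    ∑ (colourings m n) (λ g → ∑ (upTo m) (new g) + (𝟙 (proper g E) + 𝟙 (proper g E)))
      ≡⟨ ∑-cong-All (colourings-bounded m n) (λ {g} bg → count g bg (proper g E) refl) ⟩
    ∑ (colourings m n) (λ g → 𝟙 (proper g E) * 𝟙 (Vec.lookup g a ≡ᵇ Vec.lookup g b) + m * 𝟙 (proper g E))
      ≡⟨ ∑-distrib-+ (colourings m n) _ _ ⟩
    properColouringsAgreeing m (graph n E) a b + ∑ (colourings m n) (λ g → m * 𝟙 (proper g E))
      ≡⟨ cong (properColouringsAgreeing m (graph n E) a b +_) (*-distribˡ-∑ m (colourings m n) _) ⟨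
    properColouringsAgreeing m (graph n E) a b + m * N ∎
    where
    open ≡-Reasoning
    N : ℕ
    N = properColourings m (graph n E)
    new : Vec ℕ n → ℕ → ℕ
    new g i = 𝟙 (proper (Vec.insertAt g (fromℕ n) i) ((inject₁ a , fromℕ n) ∷ (inject₁ b , fromℕ n) ∷ map injE E))
    new≡ : ∀ g i → new g i ≡ 𝟙 ((not (Vec.lookup g a ≡ᵇ i) ∧ not (Vec.lookup g b ≡ᵇ i)) ∧ proper g E)
    new≡ g i rewrite Vec.insertAt-lookup g (fromℕ n) i | lookup-insertAt-last g i a | lookup-insertAt-last g i b
                   | proper-insertAt-last g i E = cong 𝟙 (sym (∧-assoc (not (Vec.lookup g a ≡ᵇ i)) _ _))
    count : ∀ g → Bounded m g → ∀ p → proper g E ≡ p →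
      ∑ (upTo m) (new g) + (𝟙 p + 𝟙 p) ≡ 𝟙 p * 𝟙 (Vec.lookup g a ≡ᵇ Vec.lookup g b) + m * 𝟙 p
    count g bg false eq rewrite ∑-cong (upTo m) (new≡ g) | eq =
      trans (cong (_+ 0) (∑-zero (upTo m) (λ i → cong 𝟙 (∧-zeroʳ _)))) (sym (*-zeroʳ m))
    count g bg true  eq rewrite ∑-cong (upTo m) (new≡ g) | eq =
      trans (cong (_+ 2) (∑-cong (upTo m) (λ i → cong 𝟙 (∧-identityʳ _))))
            (trans (colours-avoiding₂ (bg a) (bg b)) (cong₂ _+_ (sym (+-identityʳ _)) (sym (*-identityʳ m))))

  properColourings-addCommonNeighbour-twice : ∀ m G c →
    properColourings m (addCommonNeighbour G c c) + properColourings m G ≡ m * properColourings m G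
  properColourings-addCommonNeighbour-twice m G c = +-cancelˡ-≡ N _ _ (begin
    N + (properColourings m (addCommonNeighbour G c c) + N)  ≡⟨ x∙yz≈y∙xz N _ N ⟩
    properColourings m (addCommonNeighbour G c c) + (N + N)  ≡⟨ properColourings-addCommonNeighbour m G c c ⟩
    properColouringsAgreeing m G c c + m * N                 ≡⟨ cong (_+ m * N) (properColouringsAgreeing-refl m G c) ⟩
    N + m * N                                                ∎)
    where
    open ≡-Reasoning
    N : ℕ
    N = properColourings m G

  relabel-cong : ∀ {n k} {σ τ : Fin n → Fin k} → (∀ u → σ u ≡ τ u) → ∀ E → relabel σ E ≡ relabel τ E
  relabel-cong σ≗τ = map-cong (λ p → cong₂ _,_ (σ≗τ (proj₁ p)) (σ≗τ (proj₂ p)))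

  relabel-∘ : ∀ {n k l} (σ : Fin k → Fin l) (τ : Fin n → Fin k) E → relabel σ (relabel τ E) ≡ relabel (σ ∘ τ) E
  relabel-∘ σ τ E = sym (map-∘ E)

  lookup-map-cast : ∀ {A A′ : Set} (f : A → A′) (L : List A) (i : Fin (length L)) .(eq : length L ≡ length (map f L)) →
    lookup (map f L) (cast eq i) ≡ f (lookup L i)
  lookup-map-cast f (x ∷ L) zero    eq = refl
  lookup-map-cast f (x ∷ L) (suc i) eq = lookup-map-cast f L i (suc-injective eq)

  contract-loop : ∀ {n} (L : List (Fin n × Fin n)) i {x} → lookup L i ≡ (x , x) →
    contract (rooted (graph n L) i) ≡ graph n (removeAt L i)
  contract-loop L i {x} eq with lookup L i | eq
  ... | _ | refl with x Fin.≟ x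
  ...   | yes _  = refl
  ...   | no x≢x = ⊥-elim (x≢x refl)

  contract-nonLoop : ∀ {n} (L : List (Fin n × Fin n)) i {x y} → lookup L i ≡ (x , y) → x ≢ y →
    Σ (x ≢ y) λ x≢y → contract (rooted (graph n L) i) ≡ contractNonLoop x y x≢y (removeAt L i)
  contract-nonLoop L i {x} {y} eq x≢y with lookup L i | eq
  ... | _ | refl with x Fin.≟ y
  ...   | yes x≡y  = ⊥-elim (x≢y x≡y)
  ...   | no x≢y′  = x≢y′ , refl

  module _ {n} (a : Fin n) (a≢w : inject₁ a ≢ fromℕ n) where

    mergeV-fromℕ-inject₁ : ∀ u → mergeV (inject₁ a) (fromℕ n) a≢w (inject₁ u) ≡ u
    mergeV-fromℕ-inject₁ u = mergeV-unique a≢w (inject₁≢fromℕ u) (punchIn-fromℕ u)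

    mergeV-fromℕ : mergeV (inject₁ a) (fromℕ n) a≢w (fromℕ n) ≡ a
    mergeV-fromℕ = trans (mergeV-b a≢w) (mergeV-fromℕ-inject₁ a)

  module _ {n} {a b : Fin (suc n)} (a≢b : a ≢ b) (a≢b′ : inject₁ a ≢ inject₁ b) where

    mergeV-inject₁ : ∀ u → mergeV (inject₁ a) (inject₁ b) a≢b′ (inject₁ u) ≡ inject₁ (mergeV a b a≢b u)
    mergeV-inject₁ u = by-cases (u Fin.≟ b)
      where
      by-cases : Dec (u ≡ b) → mergeV (inject₁ a) (inject₁ b) a≢b′ (inject₁ u) ≡ inject₁ (mergeV a b a≢b u)
      by-cases (no u≢b)  = mergeV-unique a≢b′ (u≢b ∘ Fin.inject₁-injective)
                             (trans (punchIn-inject₁ b _) (cong inject₁ (mergeV-punchIn a≢b u≢b)))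
      by-cases (yes u≡b) = begin
        mergeV (inject₁ a) (inject₁ b) a≢b′ (inject₁ u) ≡⟨ cong (mergeV _ _ a≢b′ ∘ inject₁) u≡b ⟩
        mergeV (inject₁ a) (inject₁ b) a≢b′ (inject₁ b) ≡⟨ mergeV-b a≢b′ ⟩
        mergeV (inject₁ a) (inject₁ b) a≢b′ (inject₁ a) ≡⟨ mergeV-unique a≢b′ a≢b′ a↦a ⟩
        inject₁ (mergeV a b a≢b a)                      ≡⟨ cong inject₁ (trans (cong (mergeV a b a≢b) u≡b) (mergeV-b a≢b)) ⟨
        inject₁ (mergeV a b a≢b u)                      ∎
        where
        open ≡-Reasoning
        a↦a : punchIn (inject₁ b) (inject₁ (mergeV a b a≢b a)) ≡ inject₁ a
        a↦a = trans (punchIn-inject₁ b _) (cong inject₁ (mergeV-punchIn a≢b a≢b))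

    mergeV-inject₁-fromℕ : mergeV (inject₁ a) (inject₁ b) a≢b′ (fromℕ (suc n)) ≡ fromℕ n
    mergeV-inject₁-fromℕ = mergeV-unique a≢b′ (inject₁≢fromℕ b ∘ sym) (punchIn-inject₁-fromℕ b)

  contractNonLoop-addCommonNeighbour : ∀ {n} {a b : Fin n} (a≢b : a ≢ b) (a≢b′ : inject₁ a ≢ inject₁ b) E →
    Σ (Fin (Graph.n (contractNonLoop a b a≢b E))) λ c →
      contractNonLoop (inject₁ a) (inject₁ b) a≢b′ ((inject₁ a , fromℕ n) ∷ (inject₁ b , fromℕ n) ∷ map injE E)
        ≡ addCommonNeighbour (contractNonLoop a b a≢b E) c c
  contractNonLoop-addCommonNeighbour {suc n} {a} {b} a≢b a≢b′ E =
    μ a , cong (graph (suc n)) (cong₂ _∷_ (cong₂ _,_ (μ′-inject₁ a) w↦w) (cong₂ _∷_ (cong₂ _,_ b↦a w↦w) edges))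
    where
    μ : Fin (suc n) → Fin n
    μ = mergeV a b a≢b
    μ′-inject₁ : ∀ u → mergeV (inject₁ a) (inject₁ b) a≢b′ (inject₁ u) ≡ inject₁ (μ u)
    μ′-inject₁ = mergeV-inject₁ a≢b a≢b′
    w↦w : mergeV (inject₁ a) (inject₁ b) a≢b′ (fromℕ (suc n)) ≡ fromℕ n
    w↦w = mergeV-inject₁-fromℕ a≢b a≢b′
    b↦a : mergeV (inject₁ a) (inject₁ b) a≢b′ (inject₁ b) ≡ inject₁ (μ a)
    b↦a = trans (μ′-inject₁ b) (cong inject₁ (mergeV-b a≢b))
    edges : relabel (mergeV (inject₁ a) (inject₁ b) a≢b′) (map injE E) ≡ map injE (relabel μ E)
    edges = trans (relabel-∘ _ inject₁ E) (trans (relabel-cong μ′-inject₁ E) (sym (relabel-∘ inject₁ μ E)))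

  module _ {n} (E : List (Fin n × Fin n)) (e : Fin (length E)) where

    private
      X : Rooted
      X = rooted (graph n E) e
      a b : Fin n
      a = proj₁ (lookup E e)
      b = proj₂ (lookup E e)
      E⁻ : List (Fin n × Fin n)
      E⁻ = removeAt E e
      LB : List (Fin (suc n) × Fin (suc n))
      LB = (inject₁ a , fromℕ n) ∷ (inject₁ b , fromℕ n) ∷ map injE E
      iB : Fin (length LB)
      iB = suc (suc (cast (sym (length-map injE E)) e))

    lookup-B : lookup LB iB ≡ (inject₁ a , inject₁ b)
    lookup-B = lookup-map-cast injE E e _

    removeAt-B : removeAt LB iB ≡ (inject₁ a , fromℕ n) ∷ (inject₁ b , fromℕ n) ∷ map injE E⁻
    removeAt-B = cong (λ L → (inject₁ a , fromℕ n) ∷ (inject₁ b , fromℕ n) ∷ L) (sym (map-removeAt E e injE))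

    delete-B : delete (B X) ≡ addCommonNeighbour (graph n E⁻) a b
    delete-B = cong (graph (suc n)) removeAt-B

    contract-S : contract (S X) ≡ graph n ((a , b) ∷ E⁻)
    contract-S with contract-nonLoop ((inject₁ a , fromℕ n) ∷ (fromℕ n , inject₁ b) ∷ map injE E⁻) zero refl
                                     (inject₁≢fromℕ a)
    ... | a≢w , eq =
      trans eq (cong (graph n) (cong₂ _∷_ (cong₂ _,_ (mergeV-fromℕ a a≢w) (mergeV-fromℕ-inject₁ a a≢w b)) edges))
      where
      edges : relabel (mergeV (inject₁ a) (fromℕ n) a≢w) (map injE E⁻) ≡ E⁻
      edges = trans (relabel-∘ _ inject₁ E⁻) (trans (relabel-cong (mergeV-fromℕ-inject₁ a a≢w) E⁻) (map-id E⁻))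

    properColourings-contract : ∀ m → properColourings m (contract X) ≡ properColouringsAgreeing m (graph n E⁻) a b
    properColourings-contract m = by-cases (a Fin.≟ b)
      where
      by-cases : Dec (a ≡ b) → properColourings m (contract X) ≡ properColouringsAgreeing m (graph n E⁻) a b
      by-cases (yes a≡b) = begin
        properColourings m (contract X)                 ≡⟨ cong (properColourings m) (contract-loop E e (cong (a ,_) (sym a≡b))) ⟩
        properColourings m (graph n E⁻)                 ≡⟨ properColouringsAgreeing-refl m (graph n E⁻) a ⟨
        properColouringsAgreeing m (graph n E⁻) a a     ≡⟨ cong (properColouringsAgreeing m (graph n E⁻) a) a≡b ⟩
        properColouringsAgreeing m (graph n E⁻) a b     ∎
        where open ≡-Reasoning
      by-cases (no a≢b) with contract-nonLoop E e refl a≢b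
      ... | a≢b′ , eq = trans (cong (properColourings m) eq) (properColourings-contractNonLoop m a b a≢b′ E⁻)

    properColourings-contract-B : ∀ m →
      properColourings m (contract (B X)) + properColourings m (contract X) ≡ m * properColourings m (contract X)
    properColourings-contract-B m = by-cases (a Fin.≟ b)
      where
      via-shape : ∀ {G} c → contract X ≡ G → contract (B X) ≡ addCommonNeighbour G c c →
        properColourings m (contract (B X)) + properColourings m (contract X) ≡ m * properColourings m (contract X)
      via-shape c refl eqB rewrite eqB = properColourings-addCommonNeighbour-twice m (contract X) c
      by-cases : Dec (a ≡ b) →
        properColourings m (contract (B X)) + properColourings m (contract X) ≡ m * properColourings m (contract X)
      by-cases (yes a≡b) = via-shape a (contract-loop E e (cong (a ,_) (sym a≡b)))
        (trans (contract-loop LB iB (trans lookup-B (cong (λ v → inject₁ a , inject₁ v) (sym a≡b))))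
               (trans delete-B (cong (addCommonNeighbour (graph n E⁻) a) (sym a≡b))))
      by-cases (no a≢b) with contract-nonLoop E e refl a≢b | contract-nonLoop LB iB lookup-B (a≢b ∘ Fin.inject₁-injective)
      ... | a≢b′ , eqX | a≢b″ , eqB with contractNonLoop-addCommonNeighbour a≢b′ a≢b″ E⁻
      ...   | c , shape = via-shape c eqX (trans eqB (trans (cong (contractNonLoop _ _ a≢b″) removeAt-B) shape))

    properColourings-contract-S : ∀ m →
      properColourings m (contract (S X)) + properColourings m (contract X) ≡ properColourings m (delete X)
    properColourings-contract-S m =
      trans (cong₂ _+_ (cong (properColourings m) contract-S) (properColourings-contract m)) (properColourings-∷ m a b E⁻)

    properColourings-delete-S : ∀ m →
      properColourings m (delete (S X)) + properColourings m (delete X) ≡ m * properColourings m (delete X)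
    properColourings-delete-S m = properColourings-addPendant m (graph n E⁻) b

    properColourings-delete-B : ∀ m →
      properColourings m (delete (B X)) + (properColourings m (delete X) + properColourings m (delete X))
        ≡ properColourings m (contract X) + m * properColourings m (delete X)
    properColourings-delete-B m = begin
      properColourings m (delete (B X)) + (N + N)
        ≡⟨ cong (λ G → properColourings m G + (N + N)) delete-B ⟩
      properColourings m (addCommonNeighbour (graph n E⁻) a b) + (N + N)
        ≡⟨ properColourings-addCommonNeighbour m (graph n E⁻) a b ⟩
      properColouringsAgreeing m (graph n E⁻) a b + m * N
        ≡⟨ cong (_+ m * N) (properColourings-contract m) ⟨
      properColourings m (contract X) + m * N ∎
      where
      open ≡-Reasoning
      N : ℕ
      N = properColourings m (delete X)

module Evaluation {c ℓ} (R : CommutativeRing c ℓ) where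
  open CommutativeRing R
  open Chromatic R
  open ListSum commutativeSemiring
  open Counting using (𝟙; ≡ᵇ-sym; blockCounts; timesX; multiplicity; multiplicity-unique;
                       ChromaticExpr; χ; _⊕_; X·_; evalℕ; fallingExpansion; evalℕ≡∑-fallingExpansion)
  open import Relation.Binary.Reasoning.Setoid setoid
  open import Algebra.Properties.Group +-group using (x≈z//y; //-rightDividesˡ)
  open import Algebra.Properties.Ring ring using (x[y-z]≈xy-xz; [y-z]x≈yx-zx)
  open import Data.List.Extrema.Nat using (max; xs≤max)

  natR-+ : ∀ a b → natR (a ℕ.+ b) ≈ natR a + natR b
  natR-+ zero    b = sym (+-identityˡ _)
  natR-+ (suc a) b = trans (+-congˡ (natR-+ a b)) (sym (+-assoc _ _ _))

  P≈∑-blockCounts : ∀ G x → P G x ≈ ∑ (blockCounts G) (falling x)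
  P≈∑-blockCounts (graph n E) x = begin
    P (graph n E) x
      ≡⟨ foldr≡∑ (rgs n) _ ⟩
    ∑ (rgs n) (λ ck → if proper (proj₁ ck) E then falling x (proj₂ ck) else 0#)
      ≈⟨ ∑-filterᵇ _ (rgs n) (falling x ∘ proj₂) ⟨
    ∑ (filterᵇ (λ ck → proper (proj₁ ck) E) (rgs n)) (falling x ∘ proj₂)
      ≈⟨ ∑-map proj₂ (filterᵇ (λ ck → proper (proj₁ ck) E) (rgs n)) (falling x) ⟨
    ∑ (blockCounts (graph n E)) (falling x) ∎

  ∑-replicate : ∀ k j (f : ℕ → Carrier) → ∑ (replicate k j) f ≈ natR k * f j
  ∑-replicate zero    j f = sym (zeroˡ _)
  ∑-replicate (suc k) j f = trans (+-cong (sym (*-identityˡ _)) (∑-replicate k j f)) (sym (distribʳ _ _ _))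

  *-falling : ∀ x k → x * falling x k ≈ falling x (suc k) + natR k * falling x k
  *-falling x k = begin
    x * falling x k                                                 ≈⟨ *-comm x _ ⟩
    falling x k * x                                                 ≈⟨ //-rightDividesˡ (falling x k * natR k) _ ⟨
    falling x k * x - falling x k * natR k + falling x k * natR k   ≈⟨ +-cong (x[y-z]≈xy-xz _ _ _) (*-comm _ _) ⟨
    falling x (suc k) + natR k * falling x k                        ∎

  ∑-timesX : ∀ x L → ∑ (timesX L) (falling x) ≈ x * ∑ L (falling x)
  ∑-timesX x L = begin
    ∑ (timesX L) (falling x)
      ≈⟨ ∑-concatMap _ L (falling x) ⟩
    ∑ L (λ k → falling x (suc k) + ∑ (replicate k k) (falling x))
      ≈⟨ ∑-cong L (λ k → trans (+-congˡ (∑-replicate k k (falling x))) (sym (*-falling x k))) ⟩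
    ∑ L (λ k → x * falling x k)
      ≈⟨ *-distribˡ-∑ x L (falling x) ⟨
    x * ∑ L (falling x) ∎

  ∑-by-multiplicity : ∀ {b} L (f : ℕ → Carrier) → All (ℕ._< b) L →
    ∑ L f ≈ ∑ (upTo b) (λ k → natR (multiplicity k L) * f k)
  ∑-by-multiplicity {b} []      f []           = sym (∑-zero (upTo b) (λ _ → zeroˡ _))
  ∑-by-multiplicity {b} (y ∷ L) f (y<b ∷ L<b) = begin
    f y + ∑ L f
      ≈⟨ +-cong (sym (∑-upTo-select f y<b)) (∑-by-multiplicity L f L<b) ⟩
    ∑ (upTo b) (λ k → if k ℕ.≡ᵇ y then f k else 0#) + ∑ (upTo b) (λ k → natR (multiplicity k L) * f k)
      ≈⟨ ∑-distrib-+ (upTo b) _ _ ⟨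
    ∑ (upTo b) (λ k → (if k ℕ.≡ᵇ y then f k else 0#) + natR (multiplicity k L) * f k)
      ≈⟨ ∑-cong (upTo b) split ⟩
    ∑ (upTo b) (λ k → natR (multiplicity k (y ∷ L)) * f k) ∎
    where
    indicator : ∀ k → (if k ℕ.≡ᵇ y then f k else 0#) ≈ natR (𝟙 (y ℕ.≡ᵇ k)) * f k
    indicator k rewrite ≡ᵇ-sym y k with k ℕ.≡ᵇ y
    ... | true  = sym (trans (*-congʳ (+-identityʳ 1#)) (*-identityˡ _))
    ... | false = sym (zeroˡ _)
    split : ∀ k → (if k ℕ.≡ᵇ y then f k else 0#) + natR (multiplicity k L) * f k ≈ natR (multiplicity k (y ∷ L)) * f k
    split k = trans (+-congʳ (indicator k)) (trans (sym (distribʳ _ _ _)) (*-congʳ (sym (natR-+ (𝟙 (y ℕ.≡ᵇ k)) _))))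

  ∑-cong-multiplicity : ∀ L₁ L₂ → (∀ k → multiplicity k L₁ ≡.≡ multiplicity k L₂) →
    (f : ℕ → Carrier) → ∑ L₁ f ≈ ∑ L₂ f
  ∑-cong-multiplicity L₁ L₂ same f = begin
    ∑ L₁ f
      ≈⟨ ∑-by-multiplicity L₁ f (All.++⁻ˡ L₁ below) ⟩
    ∑ (upTo bound) (λ k → natR (multiplicity k L₁) * f k)
      ≈⟨ ∑-cong (upTo bound) (λ k → reflexive (≡.cong (λ i → natR i * f k) (same k))) ⟩
    ∑ (upTo bound) (λ k → natR (multiplicity k L₂) * f k)
      ≈⟨ ∑-by-multiplicity L₂ f (All.++⁻ʳ L₁ below) ⟨
    ∑ L₂ f ∎
    where
    bound : ℕ
    bound = suc (max 0 (L₁ ++ L₂))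
    below : All (ℕ._< bound) (L₁ ++ L₂)
    below = All.map ℕ.s≤s (xs≤max 0 (L₁ ++ L₂))

  eval : ChromaticExpr → Carrier → Carrier
  eval (χ G)     x = P G x
  eval (e₁ ⊕ e₂) x = eval e₁ x + eval e₂ x
  eval (X· e)    x = x * eval e x

  eval≈∑-fallingExpansion : ∀ e x → eval e x ≈ ∑ (fallingExpansion e) (falling x)
  eval≈∑-fallingExpansion (χ G)     x = P≈∑-blockCounts G x
  eval≈∑-fallingExpansion (e₁ ⊕ e₂) x =
    trans (+-cong (eval≈∑-fallingExpansion e₁ x) (eval≈∑-fallingExpansion e₂ x))
          (sym (∑-++ (fallingExpansion e₁) (fallingExpansion e₂) (falling x)))
  eval≈∑-fallingExpansion (X· e)    x =
    trans (*-congˡ (eval≈∑-fallingExpansion e x)) (sym (∑-timesX x (fallingExpansion e)))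

  -- Both sides are ℕ-combinations of falling factorials, and agreement at every m ∈ ℕ forces
  -- equal multiplicities.
  transfer : ∀ e₁ e₂ → (∀ m → evalℕ e₁ m ≡.≡ evalℕ e₂ m) → ∀ x → eval e₁ x ≈ eval e₂ x
  transfer e₁ e₂ same x = begin
    eval e₁ x          ≈⟨ eval≈∑-fallingExpansion e₁ x ⟩
    ∑ L₁ (falling x)   ≈⟨ ∑-cong-multiplicity L₁ L₂ (multiplicity-unique L₁ L₂ same-expansions) (falling x) ⟩
    ∑ L₂ (falling x)   ≈⟨ eval≈∑-fallingExpansion e₂ x ⟨
    eval e₂ x          ∎
    where
    L₁ L₂ : List ℕ
    L₁ = fallingExpansion e₁
    L₂ = fallingExpansion e₂
    same-expansions : ∀ m → Counting.∑ L₁ (Counting.fallingℕ m) ≡.≡ Counting.∑ L₂ (Counting.fallingℕ m)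
    same-expansions m =
      ≡.trans (≡.sym (evalℕ≡∑-fallingExpansion e₁ m)) (≡.trans (same m) (evalℕ≡∑-fallingExpansion e₂ m))

  a+t≈u⇒a≈-t+u : ∀ {a t u} → a + t ≈ u → a ≈ - t + u
  a+t≈u⇒a≈-t+u {a} {t} {u} eq = trans (x≈z//y a t u eq) (+-comm u (- t))

  a+u≈xu⇒a≈[x-1]u : ∀ {a u} x → a + u ≈ x * u → a ≈ (x - 1#) * u
  a+u≈xu⇒a≈[x-1]u {a} {u} x eq = begin
    a                    ≈⟨ x≈z//y a u (x * u) eq ⟩
    x * u - u            ≈⟨ +-congˡ (-‿cong (*-identityˡ u)) ⟨
    x * u - 1# * u       ≈⟨ [y-z]x≈yx-zx u x 1# ⟨
    (x - 1#) * u         ∎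

  a+2u≈t+xu⇒a≈t+[x-2]u : ∀ {a t u} x → a + (u + u) ≈ t + x * u → a ≈ t + (x - (1# + 1#)) * u
  a+2u≈t+xu⇒a≈t+[x-2]u {a} {t} {u} x eq = begin
    a                                ≈⟨ x≈z//y a (u + u) (t + x * u) eq ⟩
    t + x * u - (u + u)              ≈⟨ +-assoc t (x * u) _ ⟩
    t + (x * u - (u + u))            ≈⟨ +-congˡ (+-congˡ (-‿cong two-u)) ⟩
    t + (x * u - (1# + 1#) * u)      ≈⟨ +-congˡ ([y-z]x≈yx-zx u x (1# + 1#)) ⟨
    t + (x - (1# + 1#)) * u          ∎
    where
    two-u : u + u ≈ (1# + 1#) * u
    two-u = sym (trans (distribʳ u 1# 1#) (+-cong (*-identityˡ u) (*-identityˡ u)))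

lemma4p3 : ∀ {c ℓ} (R : CommutativeRing c ℓ) →
    let open CommutativeRing R
        open Chromatic R
    in ∀ (q : Carrier) (X : Rooted) →
       let t = proj₁ (w q X)
           u = proj₂ (w q X)
       in ((proj₁ (w q (S X)) ≈ (- t) + u)
           × (proj₂ (w q (S X)) ≈ (q - 1#) * u))
          × ((proj₁ (w q (B X)) ≈ (q - 1#) * t)
           × (proj₂ (w q (B X)) ≈ t + (q - (1# + 1#)) * u))
lemma4p3 R q X@(rooted (graph n E) e) =
    ( a+t≈u⇒a≈-t+u (transfer (χ (contract (S X)) ⊕ χ (contract X)) (χ (delete X)) (properColourings-contract-S E e) q)
    , a+u≈xu⇒a≈[x-1]u q (transfer (χ (delete (S X)) ⊕ χ (delete X)) (X· χ (delete X)) (properColourings-delete-S E e) q))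
  , ( a+u≈xu⇒a≈[x-1]u q (transfer (χ (contract (B X)) ⊕ χ (contract X)) (X· χ (contract X)) (properColourings-contract-B E e) q)
    , a+2u≈t+xu⇒a≈t+[x-2]u q
        (transfer (χ (delete (B X)) ⊕ (χ (delete X) ⊕ χ (delete X))) (χ (contract X) ⊕ X· χ (delete X))
                  (properColourings-delete-B E e) q))
  where
  open Evaluation R
  open Counting using (χ; _⊕_; X·_; properColourings-contract-S; properColourings-delete-S;
                       properColourings-contract-B; properColourings-delete-B)
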